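{- Let $n$ be a positive integer and let $nZ^{PTS}$, $nL^{PTS}$ and $nS^{PTS}$ be the classes of progressing timed systems (each taken together with an initial configuration and a critical configuration specification) satisfying, respectively, the $n$-$Z$, $n$-$L$ and $n$-$S$ properties with respect to lazy time sampling. Then $nS^{PTS}\subsetneq nL^{PTS}\subsetneq nZ^{PTS}$.
   Context: A fact is $P(u_1,\dots,u_n)$ over a finite first-order typed alphabet; a timestamped fact is $F@t$, $t\in\mathbb{N}$. A configuration is a finite multiset of ground timestamped facts with exactly one fact $Time@t$ (global time $t$). The $Tick$ rule is $Time@T\to Time@(T+1)$. An instantaneous rule has the form $Time@T, W_1@T_1,\dots,W_p@T_p, F_1@T_1',\dots,F_n@T_n' \mid \mathcal{C} \to \exists \vec X.[Time@T, W_1@T_1,\dots,W_p@T_p, Q_1@(T+d_1),\dots,Q_m@(T+d_m)]$ with $d_i\in\mathbb{N}$, $\mathcal{C}$ a set of constraints $T_a>T_b\pm d$ or $T_a=T_b\pm d$ over the precondition's time variables, $\vec X$ fresh values; the $F_i@T_i'$ are consumed. A rule $\mathcal{W}\mid\mathcal{C}\to\exists\vec X.\mathcal{W}'$ applies to $\mathcal{S}$ if for a ground substitution $\sigma$, $\mathcal{W}\sigma\subseteq\mathcal{S}$ and $\mathcal{C}\sigma$ holds, giving $((\mathcal{S}\setminus\mathcal{W})\cup\mathcal{W}')\sigma$. A timed MSR system is a set of instantaneous rules plus $Tick$; it is a progressing timed system (PTS) if every instantaneous rule has $m=n$, has $d_i\ge1$ for at least one $i$, and has $\mathcal{C}$ containing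 $T\ge T_i'$ for each consumed $F_i@T_i'$. A trace is a finite or infinite sequence of single rule applications. A critical configuration specification is a set of pairs $\langle\mathcal{S}_j,\mathcal{C}_j\rangle$, $\mathcal{S}_j$ a finite multiset of facts $F@T$ with time variables, $\mathcal{C}_j$ constraints on them; $\mathcal{S}$ is critical if some $\mathcal{S}_j\sigma\subseteq\mathcal{S}$ with $\mathcal{C}_j\sigma$ true for a ground substitution $\sigma$ (nonces renamed). A trace is compliant if it contains no critical configuration. A trace uses lazy time sampling (l.t.s.) if whenever $\mathcal{S}_i\to_{Tick}\mathcal{S}_{i+1}$ occurs, no instantaneous rule instance is applicable to $\mathcal{S}_i$. With $\mathcal{S}_0$ the initial configuration: $n$-$Z$: there is a compliant trace from $\mathcal{S}_0$ using l.t.s. with exactly $n$ $Tick$ steps. $n$-$S$: $n$-$Z$ holds and all traces from $\mathcal{S}_0$ using l.t.s. with exactly $n$ $Tick$ steps are compliant. $n$-$L$: $n$-$Z$ holds and for every compliant trace $\mathcal{P}$ from $\mathcal{S}_0$ using l.t.s. with at most $n$ $Tick$ steps there is a trace $\mathcal{P}'$ using l.t.s. that extends $\mathcal{P}$, is compliant, and has exactly $n$ $Tick$ steps. -}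

module Defs where

open import Data.Nat using (ℕ; zero; suc; _+_; _≤_; _<_)
open import Data.Fin using (Fin; zero; suc)
open import Data.List using (List; []; _∷_; _++_; length; map)
open import Data.List.Relation.Unary.All as All using (All; []; _∷_)
open import Data.List.Relation.Unary.Any using (Any)
open import Data.List.Membership.Propositional using (_∈_)
open import Data.List.Relation.Binary.Permutation.Propositional using (_↭_)
open import Data.Maybe using (Maybe; just; nothing)
import Data.Maybe as Maybe
open import Data.Product using (Σ; _×_; _,_; proj₁; proj₂; ∃)
open import Data.Sum using (_⊎_)
open import Data.Empty using (⊥)
open import Data.Unit using (⊤)
open import Relation.Nullary using (¬_)
open import Relation.Binary.PropositionalEquality using (_≡_)

-- Time constraints  T_a ⋈ T_b ± d  with ⋈ ∈ {>, =, ≥}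
-- (T_a ≥ T_b ± d abbreviates T_a > T_b ± d - 1; it is used to express
--  the progressing condition  T ≥ T_i').

data Sign : Set where
  plus minus : Sign

data Rel : Set where
  gt eq ge : Rel

record Constraint (V : Set) : Set where
  constructor con
  field
    rel  : Rel
    lhs  : V
    sign : Sign
    rhs  : V
    off  : ℕ
-- con ρ a s b d  means   a ρ b (s) d,  evaluated over the integers;
-- below it is rewritten without subtraction over ℕ.

holds : ∀ {V : Set} → (V → ℕ) → Constraint V → Set
holds τ (con gt a plus  b d) = τ b + d < τ a
holds τ (con gt a minus b d) = τ b < τ a + d
holds τ (con eq a plus  b d) = τ a ≡ τ b + d
holds τ (con eq a minus b d) = τ a + d ≡ τ b
holds τ (con ge a plus  b d) = τ b + d ≤ τ a
holds τ (con ge a minus b d) = τ b ≤ τ a + d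

record Sig : Set where
  field
    nSort     : ℕ
    nPred     : ℕ
    arity     : Fin nPred → List (Fin nSort)
    nConst    : ℕ
    constSort : Fin nConst → Fin nSort

stampWith : ∀ {A B : Set} (xs : List A) → (A → B) → (Fin (length xs) → ℕ) → List (B × ℕ)
stampWith []       g t = []
stampWith (x ∷ xs) g t = (g x , t zero) ∷ stampWith xs g (λ i → t (suc i))

data TVar (p q : ℕ) : Set where
  now : TVar p q
  w   : Fin p → TVar p q
  f   : Fin q → TVar p q

module _ (sig : Sig) where
  open Sig sig

  Sort : Set
  Sort = Fin nSort

  data Val (s : Sort) : Set where
    cst   : (c : Fin nConst) → constSort c ≡ s → Val s
    nonce : ℕ → Val s

  data Term (V : Sort → Set) (s : Sort) : Set where
    const : (c : Fin nConst) → constSort c ≡ s → Term V s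
    var   : V s → Term V s

  record Fact (V : Sort → Set) : Set where
    constructor fact
    field
      pred : Fin nPred
      args : All (Term V) (arity pred)

  record GFact : Set where
    constructor gfact
    field
      pred : Fin nPred
      args : All Val (arity pred)

  instT : ∀ {V : Sort → Set} → (∀ {s} → V s → Val s) → ∀ {s} → Term V s → Val s
  instT σ (const c e) = cst c e
  instT σ (var v)     = σ v

  inst : ∀ {V : Sort → Set} → (∀ {s} → V s → Val s) → Fact V → GFact
  inst σ (fact p as) = gfact p (All.map (instT σ) as)

  -- configuration: the unique fact Time@time plus a finite multiset
  -- (list up to permutation) of other ground timestamped facts
  record Config : Set where
    constructor config
    field
      time  : ℕ
      facts : List (GFact × ℕ)
  open Config

  isNonce : ∀ {s} → ℕ → Val s → Set
  isNonce k (cst c e) = ⊥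
  isNonce k (nonce j) = j ≡ k

  occursArgs : ∀ {ss} → ℕ → All Val ss → Set
  occursArgs k []       = ⊥
  occursArgs k (v ∷ vs) = isNonce k v ⊎ occursArgs k vs

  OccursIn : ℕ → Config → Set
  OccursIn k S = Any (λ ft → occursArgs k (GFact.args (proj₁ ft))) (facts S)

  -- rule variables: ordinary variables (positions in vars) and
  -- existentially quantified fresh variables (positions in fresh)
  data RVar (vs xs : List Sort) (s : Sort) : Set where
    old : s ∈ vs → RVar vs xs s
    new : s ∈ xs → RVar vs xs s

  -- instantaneous rule
  --  Time@T, W_1@T_1..W_p@T_p, F_1@T_1'..F_n@T_n' | C
  --    → ∃ fresh. [Time@T, W_1@T_1..W_p@T_p, Q_1@(T+d_1)..Q_m@(T+d_m)]
  record Rule : Set where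
    field
      vars  : List Sort
      fresh : List Sort
      W     : List (Fact (λ s → s ∈ vars))
      F     : List (Fact (λ s → s ∈ vars))
      Q     : List (Fact (RVar vars fresh) × ℕ)
      C     : List (Constraint (TVar (length W) (length F)))

  Pre : (r : Rule) → (∀ {s} → s ∈ Rule.vars r → Val s)
      → (TVar (length (Rule.W r)) (length (Rule.F r)) → ℕ) → List (GFact × ℕ)
  Pre r σ τ = stampWith (Rule.W r) (inst σ) (λ i → τ (w i))
           ++ stampWith (Rule.F r) (inst σ) (λ i → τ (f i))

  record Applicable (r : Rule) (S : Config) : Set where
    field
      σ    : ∀ {s} → s ∈ Rule.vars r → Val s
      τ    : TVar (length (Rule.W r)) (length (Rule.F r)) → ℕ
      rest : List (GFact × ℕ)
      timeMatch : τ now ≡ time S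
      sub  : facts S ↭ (Pre r σ τ ++ rest)
      cons : All (holds τ) (Rule.C r)

  extend : (r : Rule) → (∀ {s} → s ∈ Rule.vars r → Val s)
         → (∀ {s} → s ∈ Rule.fresh r → ℕ) → ∀ {s} → RVar (Rule.vars r) (Rule.fresh r) s → Val s
  extend r σ ρ (old p) = σ p
  extend r σ ρ (new p) = nonce (ρ p)

  record Apply (r : Rule) (S S' : Config) : Set where
    field
      app : Applicable r S
      ρ   : ∀ {s} → s ∈ Rule.fresh r → ℕ
      ρ-inj : ∀ {s s'} (p : s ∈ Rule.fresh r) (q : s' ∈ Rule.fresh r) → ρ p ≡ ρ q
            → _≡_ {A = Σ Sort (λ z → z ∈ Rule.fresh r)} (s , p) (s' , q)
      ρ-fresh : ∀ {s} (p : s ∈ Rule.fresh r) → ¬ OccursIn (ρ p) S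
      result : S' ≡ config (time S)
                 (stampWith (Rule.W r) (inst (Applicable.σ app)) (λ i → Applicable.τ app (w i))
                  ++ map (λ qd → inst (extend r (Applicable.σ app) ρ) (proj₁ qd) , time S + proj₂ qd) (Rule.Q r)
                  ++ Applicable.rest app)

  tickC : Config → Config
  tickC S = config (suc (time S)) (facts S)

  Progressing : Rule → Set
  Progressing r = (length (Rule.Q r) ≡ length (Rule.F r))
                × Any (λ qd → 1 ≤ proj₂ qd) (Rule.Q r)
                × (∀ (i : Fin (length (Rule.F r))) → con ge now plus (f i) 0 ∈ Rule.C r)

  -- critical configuration specification: pairs ⟨S_j , C_j⟩
  -- (nothing = the fact Time)
  record CritPat : Set where
    field
      vars : List Sort
      nT   : ℕ
      pats : List (Maybe (Fact (λ s → s ∈ vars)) × Fin nT)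
      C    : List (Constraint (Fin nT))

  fullMS : Config → List (Maybe GFact × ℕ)
  fullMS S = (nothing , time S) ∷ map (λ ft → just (proj₁ ft) , proj₂ ft) (facts S)

  record CritMatch (cp : CritPat) (S : Config) : Set where
    field
      σ    : ∀ {s} → s ∈ CritPat.vars cp → Val s
      τ    : Fin (CritPat.nT cp) → ℕ
      rest : List (Maybe GFact × ℕ)
      sub  : fullMS S ↭ (map (λ mt → Maybe.map (inst σ) (proj₁ mt) , τ (proj₂ mt)) (CritPat.pats cp) ++ rest)
      cons : All (holds τ) (CritPat.C cp)

  Critical : List CritPat → Config → Set
  Critical spec S = Any (λ cp → CritMatch cp S) spec

  data Step (R : List Rule) (S : Config) : Config → Set where
    tickS : Step R S (tickC S)
    instS : ∀ {r S'} → r ∈ R → Apply r S S' → Step R S S'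

  data Trace (R : List Rule) : Config → Config → Set where
    done : ∀ {S} → Trace R S S
    step : ∀ {S S' S''} → Step R S S' → Trace R S' S'' → Trace R S S''

  _++ₜ_ : ∀ {R S S' S''} → Trace R S S' → Trace R S' S'' → Trace R S S''
  done        ++ₜ t = t
  step s tr   ++ₜ t = step s (tr ++ₜ t)

  ticks : ∀ {R S S'} → Trace R S S' → ℕ
  ticks done               = 0
  ticks (step tickS tr)    = suc (ticks tr)
  ticks (step (instS _ _) tr) = ticks tr

  Compliant : ∀ {R S S'} → List CritPat → Trace R S S' → Set
  Compliant spec (done {S})       = ¬ Critical spec S
  Compliant spec (step {S} _ tr)  = ¬ Critical spec S × Compliant spec tr

  LTS : ∀ {R S S'} → Trace R S S' → Set
  LTS {R} (step {S} tickS tr)   = ¬ Any (λ r → Applicable r S) R × LTS tr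
  LTS (step (instS _ _) tr)     = LTS tr
  LTS done                      = ⊤

record System : Set where
  field
    sig   : Sig
    rules : List (Rule sig)
    init  : Config sig
    spec  : List (CritPat sig)

IsPTS : System → Set
IsPTS X = All (Progressing (System.sig X)) (System.rules X)

module _ (n : ℕ) (X : System) where
  open System X

  nZ : Set
  nZ = Σ (Config sig) λ S' → Σ (Trace sig rules init S') λ tr →
         Compliant sig spec tr × LTS sig tr × ticks sig tr ≡ n

  nS : Set
  nS = nZ × (∀ (S' : Config sig) (tr : Trace sig rules init S') →
               LTS sig tr → ticks sig tr ≡ n → Compliant sig spec tr)

  nL : Set
  nL = nZ × (∀ (S' : Config sig) (tr : Trace sig rules init S') →
               Compliant sig spec tr → LTS sig tr → ticks sig tr ≤ n →
               Σ (Config sig) λ S'' → Σ (Trace sig rules S' S'') λ ext →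
                 Compliant sig spec (_++ₜ_ sig tr ext) × LTS sig (_++ₜ_ sig tr ext)
                 × ticks sig (_++ₜ_ sig tr ext) ≡ n)

nZPTS nLPTS nSPTS : ℕ → System → Set
nZPTS n X = IsPTS X × nZ n X
nLPTS n X = IsPTS X × nL n X
nSPTS n X = IsPTS X × nS n X

_⊊_ : (System → Set) → (System → Set) → Set
A ⊊ B = (∀ X → A X → B X) × Σ System (λ X → B X × ¬ A X)

-- nS ⊆ nL: in a progressing system each instantaneous rule consumes facts that are due
-- (timestamp ≤ global time) and creates as many facts, one of them in the future, so the
-- number of due facts decreases.  Applicability being decidable (a configuration has only
-- finitely many sub-multisets to match against), every configuration reaches, after finitely
-- many rule applications, one where l.t.s. allows a tick.  So every compliant l.t.s. trace
-- with at most n ticks extends to an l.t.s. trace with exactly n ticks, compliant by nS.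
-- In nL but not nS: from a@n with the rule a → b and every b critical, compliant traces only
-- let time pass, which they can until time n; firing the rule at time n is critical.
-- In nZ but not nL: from a@0 with the rules a → b and a → c, and a due b critical, choosing c
-- gives a compliant run; after choosing b at time 0 (b@1 is not yet due) no rule applies,
-- and the next tick makes b due.
module Submission where

open import Defs
open import Data.Nat using (ℕ; zero; suc; _+_; _∸_; _≤_; _<_; z≤n; s≤s)
open import Data.Nat.Properties
  using (_≟_; _≤?_; _<?_; ≤-refl; ≤-trans; <⇒≱; m≤m+n; m≤n+m; +-identityʳ; +-suc; +-assoc;
         +-monoʳ-<; +-monoˡ-<; +-cancelˡ-≡; m+[n∸m]≡n; m∸n+n≡m; m<m+n; module ≤-Reasoning)
open import Data.Nat.Induction using (<-wellFounded)
open import Data.Fin using (Fin; zero; suc; toℕ)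
import Data.Fin.Properties as Fin
open import Data.List using (List; []; _∷_; [_]; _++_; length; map; concatMap; drop; filter)
open import Data.List.Properties as List
  using (++-assoc; map-++; length-++; length-map; filter-++; filter-all; filter-notAll)
open import Data.List.Relation.Unary.All as All using (All; []; _∷_; all?)
import Data.List.Relation.Unary.All.Properties as All
open import Data.List.Relation.Unary.Any as Any using (Any; here; there; any?; index)
import Data.List.Relation.Unary.Any.Properties as Any
open import Data.List.Membership.Propositional using (_∈_; _∉_; find)
open import Data.List.Membership.Propositional.Properties using (∈-++⁺ˡ; ∈-map⁺; ∈-map⁻)
open import Data.List.Relation.Binary.Permutation.Propositional
  using (_↭_; ↭-refl; ↭-sym; ↭-trans; ↭-reflexive; prep; swap)
open import Data.List.Relation.Binary.Permutation.Propositional.Properties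
  using (∈-resp-↭; drop-∷; shift; ++⁺ˡ; ↭-length; filter-↭)
open import Data.Maybe using (just; nothing)
open import Data.Product using (Σ; ∃; _×_; _,_; proj₁; proj₂)
import Data.Product.Properties as Product
open import Data.Sum using (inj₁; inj₂)
open import Data.Unit using (tt)
open import Function using (_∘_)
open import Induction.WellFounded using (Acc; acc)
open import Relation.Nullary using (¬_; Dec; yes; no; contradiction)
open import Relation.Nullary.Decidable using (map′; _×-dec_)
open import Relation.Binary.Definitions using (DecidableEquality)
open import Relation.Binary.PropositionalEquality
  using (_≡_; _≢_; refl; sym; trans; cong; cong₂; subst; subst₂; module ≡-Reasoning)

module _ {A : Set} where

  record Split (xs : List A) : Set where
    constructor split
    field
      taken rest : List A
      perm       : xs ↭ taken ++ rest
  open Split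

  pickOne : (xs : List A) → List (Split xs)
  pickOne []       = []
  pickOne (x ∷ xs) = split [ x ] xs ↭-refl ∷ map skip (pickOne xs)
    where
    skip : Split xs → Split (x ∷ xs)
    skip (split ys zs p) = split ys (x ∷ zs) (↭-trans (prep x p) (↭-sym (shift x ys zs)))

  pickOne-complete : ∀ {x xs} → x ∈ xs → Any ((_≡ [ x ]) ∘ taken) (pickOne xs)
  pickOne-complete (here refl) = here refl
  pickOne-complete (there x∈xs) = there (Any.map⁺ (pickOne-complete x∈xs))

  compose : ∀ {xs} (s : Split xs) → Split (rest s) → Split xs
  compose (split ys zs p) (split ys′ zs′ q) =
    split (ys ++ ys′) zs′ (↭-trans p (↭-trans (++⁺ˡ ys q) (↭-reflexive (sym (++-assoc ys ys′ zs′)))))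

  splits : ℕ → (xs : List A) → List (Split xs)
  splits zero    xs = split [] xs ↭-refl ∷ []
  splits (suc k) xs = concatMap extensions (pickOne xs)
    where
    extensions : Split xs → List (Split xs)
    extensions s = map (compose s) (splits k (rest s))

  splits-complete : ∀ ys {xs zs} → xs ↭ ys ++ zs → Any ((_≡ ys) ∘ taken) (splits (length ys) xs)
  splits-complete []       _ = here refl
  splits-complete (y ∷ ys) p =
    Any.concatMap⁺ _ (Any.map (λ {s} → extendTail s) (pickOne-complete (∈-resp-↭ (↭-sym p) (here refl))))
    where
    extendTail : ∀ s → taken s ≡ [ y ] →
                 Any ((_≡ y ∷ ys) ∘ taken) (map (compose s) (splits (length ys) (rest s)))
    extendTail (split _ _ q) refl =
      Any.map⁺ (Any.map (cong (y ∷_)) (splits-complete ys (drop-∷ (↭-trans (↭-sym q) p))))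

∈-index-injective : ∀ {A : Set} {xs : List A} {x y} (p : x ∈ xs) (q : y ∈ xs) →
                    index p ≡ index q → _≡_ {A = Σ A (_∈ xs)} (x , p) (y , q)
∈-index-injective (here refl) (here refl) _ = refl
∈-index-injective (there p)   (there q)   i≡j
  with refl ← ∈-index-injective p q (Fin.suc-injective i≡j) = refl

module _ {A B : Set} where

  length-stampWith : ∀ (xs : List A) (g : A → B) t → length (stampWith xs g t) ≡ length xs
  length-stampWith []       g t = refl
  length-stampWith (x ∷ xs) g t = cong suc (length-stampWith xs g (t ∘ suc))

  map-proj₁-stampWith : ∀ (xs : List A) (g : A → B) t → map proj₁ (stampWith xs g t) ≡ map g xs
  map-proj₁-stampWith []       g t = refl
  map-proj₁-stampWith (x ∷ xs) g t = cong (g x ∷_) (map-proj₁-stampWith xs g (t ∘ suc))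

  stampWith-cong : ∀ (xs : List A) {g g′ : A → B} {t t′} →
                   All (λ x → g x ≡ g′ x) xs → (∀ i → t i ≡ t′ i) →
                   stampWith xs g t ≡ stampWith xs g′ t′
  stampWith-cong []       []         _   = refl
  stampWith-cong (x ∷ xs) (gx≡ ∷ g≡) t≡ =
    cong₂ _∷_ (cong₂ _,_ gx≡ (t≡ zero)) (stampWith-cong xs g≡ (t≡ ∘ suc))

  stampWith-All : ∀ {P : ℕ → Set} (xs : List A) (g : A → B) t →
                  (∀ i → P (t i)) → All (P ∘ proj₂) (stampWith xs g t)
  stampWith-All []       g t _  = []
  stampWith-All (x ∷ xs) g t Pt = Pt zero ∷ stampWith-All xs g (t ∘ suc) (Pt ∘ suc)

  -- 0 past the end of the list
  stampsOf : (xs : List A) → List (B × ℕ) → Fin (length xs) → ℕ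
  stampsOf (_ ∷ _)  []            _       = 0
  stampsOf (_ ∷ _)  ((_ , t) ∷ _) zero    = t
  stampsOf (_ ∷ xs) (_ ∷ ys)      (suc i) = stampsOf xs ys i

  stampsOf-stampWith : ∀ (xs : List A) (g : A → B) t ys i → stampsOf xs (stampWith xs g t ++ ys) i ≡ t i
  stampsOf-stampWith (x ∷ xs) g t ys zero    = refl
  stampsOf-stampWith (x ∷ xs) g t ys (suc i) = stampsOf-stampWith xs g (t ∘ suc) ys i

  drop-stampWith : ∀ (xs : List A) (g : A → B) t ys → drop (length xs) (stampWith xs g t ++ ys) ≡ ys
  drop-stampWith []       g t ys = refl
  drop-stampWith (x ∷ xs) g t ys = drop-stampWith xs g (t ∘ suc) ys

holds? : ∀ {V : Set} (τ : V → ℕ) c → Dec (holds τ c)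
holds? τ (con gt a plus  b d) = τ b + d <? τ a
holds? τ (con gt a minus b d) = τ b <? τ a + d
holds? τ (con eq a plus  b d) = τ a ≟ τ b + d
holds? τ (con eq a minus b d) = τ a + d ≟ τ b
holds? τ (con ge a plus  b d) = τ b + d ≤? τ a
holds? τ (con ge a minus b d) = τ b ≤? τ a + d

holds-cong : ∀ {V : Set} {τ τ′ : V → ℕ} → (∀ v → τ v ≡ τ′ v) →
             ∀ c → holds τ c → holds τ′ c
holds-cong τ≡ (con gt a plus  b d) = subst₂ (λ x y → y + d < x) (τ≡ a) (τ≡ b)
holds-cong τ≡ (con gt a minus b d) = subst₂ (λ x y → y < x + d) (τ≡ a) (τ≡ b)
holds-cong τ≡ (con eq a plus  b d) = subst₂ (λ x y → x ≡ y + d) (τ≡ a) (τ≡ b)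
holds-cong τ≡ (con eq a minus b d) = subst₂ (λ x y → x + d ≡ y) (τ≡ a) (τ≡ b)
holds-cong τ≡ (con ge a plus  b d) = subst₂ (λ x y → y + d ≤ x) (τ≡ a) (τ≡ b)
holds-cong τ≡ (con ge a minus b d) = subst₂ (λ x y → y ≤ x + d) (τ≡ a) (τ≡ b)

module _ {sig : Sig} where

  _≟ᵛ_ : ∀ {s} → DecidableEquality (Val sig s)
  cst c refl ≟ᵛ cst c′ e with c Fin.≟ c′
  ... | no c≢c′  = no λ { refl → c≢c′ refl }
  cst c refl ≟ᵛ cst .c refl | yes refl = yes refl
  cst _ _    ≟ᵛ nonce _  = no λ ()
  nonce _    ≟ᵛ cst _ _  = no λ ()
  nonce j    ≟ᵛ nonce k  = map′ (cong nonce) (λ { refl → refl }) (j ≟ k)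

  _≟ᵃ_ : ∀ {ss} → DecidableEquality (All (Val sig) ss)
  []       ≟ᵃ []       = yes refl
  (u ∷ us) ≟ᵃ (v ∷ vs) =
    map′ (λ (u≡v , us≡vs) → cong₂ _∷_ u≡v us≡vs) (λ { refl → refl , refl }) (u ≟ᵛ v ×-dec us ≟ᵃ vs)

  _≟ᵍ_ : DecidableEquality (GFact sig)
  gfact p us ≟ᵍ gfact q vs with p Fin.≟ q
  ... | no p≢q   = no λ { refl → p≢q refl }
  ... | yes refl = map′ (cong (gfact p)) (λ { refl → refl }) (us ≟ᵃ vs)

  _≟ˢ_ : DecidableEquality (List (GFact sig × ℕ))
  _≟ˢ_ = List.≡-dec (Product.≡-dec _≟ᵍ_ _≟_)

  Stuck : List (Rule sig) → Config sig → Set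
  Stuck R S = ¬ Any (λ r → Applicable sig r S) R

  Stuck⇒¬Apply : ∀ {R r S S′} → Stuck R S → r ∈ R → ¬ Apply sig r S S′
  Stuck⇒¬Apply stuck r∈R ap = stuck (Any.map (λ { refl → Apply.app ap }) r∈R)

  nothing∈fullMS⇒time : ∀ {x} {S : Config sig} → (nothing , x) ∈ fullMS sig S → x ≡ Config.time S
  nothing∈fullMS⇒time (here refl) = refl
  nothing∈fullMS⇒time (there x∈) with _ , _ , () ← ∈-map⁻ _ x∈

  module _ {R : List (Rule sig)} where

    ticks-++ₜ : ∀ {S S′ S″} (tr : Trace sig R S S′) (ext : Trace sig R S′ S″) →
                ticks sig (_++ₜ_ sig tr ext) ≡ ticks sig tr + ticks sig ext
    ticks-++ₜ done                  ext = refl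
    ticks-++ₜ (step tickS tr)       ext = cong suc (ticks-++ₜ tr ext)
    ticks-++ₜ (step (instS _ _) tr) ext = ticks-++ₜ tr ext

    LTS-++ₜ : ∀ {S S′ S″} (tr : Trace sig R S S′) (ext : Trace sig R S′ S″) →
              LTS sig tr → LTS sig ext → LTS sig (_++ₜ_ sig tr ext)
    LTS-++ₜ done                  ext _           l = l
    LTS-++ₜ (step tickS tr)       ext (stuck , l) l′ = stuck , LTS-++ₜ tr ext l l′
    LTS-++ₜ (step (instS _ _) tr) ext l           l′ = LTS-++ₜ tr ext l l′

    module _ {spec : List (CritPat sig)} where

      Compliant-++ₜ : ∀ {S S′ S″} (tr : Trace sig R S S′) (ext : Trace sig R S′ S″) →
                      Compliant sig spec tr → Compliant sig spec ext → Compliant sig spec (_++ₜ_ sig tr ext)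
      Compliant-++ₜ done         ext _           c′ = c′
      Compliant-++ₜ (step _ tr)  ext (¬crit , c) c′ = ¬crit , Compliant-++ₜ tr ext c c′

      Compliant-++ₜ⁻ʳ : ∀ {S S′ S″} (tr : Trace sig R S S′) (ext : Trace sig R S′ S″) →
                        Compliant sig spec (_++ₜ_ sig tr ext) → Compliant sig spec ext
      Compliant-++ₜ⁻ʳ done        ext c       = c
      Compliant-++ₜ⁻ʳ (step _ tr) ext (_ , c) = Compliant-++ₜ⁻ʳ tr ext c

      Compliant⇒¬Critical : ∀ {S S′} (tr : Trace sig R S S′) →
                            Compliant sig spec tr → ¬ Critical sig spec S
      Compliant⇒¬Critical done       c       = c
      Compliant⇒¬Critical (step _ _) (c , _) = c

    idle : ∀ fs m {t u} → m + t ≡ u → Trace sig R (config t fs) (config u fs)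
    idle fs zero    refl = done
    idle fs (suc m) e    = step tickS (idle fs m (trans (+-suc m _) e))

    ticks-idle : ∀ fs m {t u} (e : m + t ≡ u) → ticks sig (idle fs m e) ≡ m
    ticks-idle fs zero    refl = refl
    ticks-idle fs (suc m) e    = cong suc (ticks-idle fs m _)

    LTS-idle : ∀ fs m {t u} (e : m + t ≡ u) →
               (∀ {t′} → t′ < u → Stuck R (config t′ fs)) → LTS sig (idle fs m e)
    LTS-idle fs zero    refl _     = tt
    LTS-idle fs (suc m) e    stuck = stuck (subst (_ <_) e (s≤s (m≤n+m _ m))) , LTS-idle fs m _ stuck

    Compliant-idle : ∀ {spec} fs m {t u} (e : m + t ≡ u) →
                     (∀ t′ → ¬ Critical sig spec (config t′ fs)) → Compliant sig spec (idle fs m e)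
    Compliant-idle fs zero    refl safe = safe _
    Compliant-idle fs (suc m) e    safe = safe _ , Compliant-idle fs m _ safe

module Matching {sig : Sig} (vs : List (Sort sig)) where

  Subst : Set
  Subst = ∀ {s} → s ∈ vs → Val sig s

  _≟ᵥ_ : DecidableEquality (Σ (Sort sig) (_∈ vs))
  (_ , x) ≟ᵥ (_ , y) = map′ (∈-index-injective x y) (cong (index ∘ proj₂)) (index x Fin.≟ index y)

  _[_≔_] : Subst → ∀ {s} → s ∈ vs → Val sig s → Subst
  (σ [ x ≔ v ]) {s} y with (s , y) ≟ᵥ (_ , x)
  ... | yes refl = v
  ... | no _     = σ y

  ≔-self : ∀ (σ : Subst) {s} (x : s ∈ vs) v → (σ [ x ≔ v ]) x ≡ v
  ≔-self σ {s} x v with (s , x) ≟ᵥ (s , x)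
  ... | yes refl = refl
  ... | no x≢x   = contradiction refl x≢x

  matchTerm : Subst → ∀ {s} → Term sig (_∈ vs) s → Val sig s → Subst
  matchTerm σ (const _ _) _ = σ
  matchTerm σ (var x)     v = σ [ x ≔ v ]

  matchArgs : Subst → ∀ {ss} → All (Term sig (_∈ vs)) ss → All (Val sig) ss → Subst
  matchArgs σ []       []       = σ
  matchArgs σ (t ∷ ts) (v ∷ us) = matchArgs (matchTerm σ t v) ts us

  matchFact : Subst → Fact sig (_∈ vs) → GFact sig → Subst
  matchFact σ (fact p ts) (gfact q us) with p Fin.≟ q
  ... | yes refl = matchArgs σ ts us
  ... | no _     = σ

  matchFacts : Subst → List (Fact sig (_∈ vs)) → List (GFact sig) → Subst
  matchFacts σ (P ∷ Ps) (G ∷ Gs) = matchFacts (matchFact σ P G) Ps Gs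
  matchFacts σ _        _        = σ

  -- Matching against instances of σ₀ never destroys agreement with σ₀, and it creates
  -- agreement on every variable it meets; so the result reproduces those instances.
  module _ (σ₀ : Subst) where

    _⊑_ : Subst → Subst → Set
    σ ⊑ σ′ = ∀ {s} (x : s ∈ vs) → σ x ≡ σ₀ x → σ′ x ≡ σ₀ x

    ⊑-trans : {σ σ′ σ″ : Subst} → σ ⊑ σ′ → σ′ ⊑ σ″ → σ ⊑ σ″
    ⊑-trans σ⊑σ′ σ′⊑σ″ x = σ′⊑σ″ x ∘ σ⊑σ′ x

    matchTerm-⊑ : ∀ (σ : Subst) {s} (t : Term sig (_∈ vs) s) → σ ⊑ matchTerm σ t (instT sig σ₀ t)
    matchTerm-⊑ σ (const _ _) _ σx≡ = σx≡
    matchTerm-⊑ σ (var x) {s′} y σy≡ with (s′ , y) ≟ᵥ (_ , x)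
    ... | yes refl = refl
    ... | no _     = σy≡

    matchArgs-⊑ : ∀ (σ : Subst) {ss} (ts : All (Term sig (_∈ vs)) ss) →
                  σ ⊑ matchArgs σ ts (All.map (instT sig σ₀) ts)
    matchArgs-⊑ σ []       = λ _ σx≡ → σx≡
    matchArgs-⊑ σ (t ∷ ts) = ⊑-trans (matchTerm-⊑ σ t) (matchArgs-⊑ _ ts)

    matchFact-⊑ : ∀ (σ : Subst) P → σ ⊑ matchFact σ P (inst sig σ₀ P)
    matchFact-⊑ σ (fact p ts) with p Fin.≟ p
    ... | yes refl = matchArgs-⊑ σ ts
    ... | no _     = λ _ σx≡ → σx≡

    matchFacts-⊑ : ∀ (σ : Subst) Ps → σ ⊑ matchFacts σ Ps (map (inst sig σ₀) Ps)
    matchFacts-⊑ σ []       = λ _ σx≡ → σx≡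
    matchFacts-⊑ σ (P ∷ Ps) = ⊑-trans (matchFact-⊑ σ P) (matchFacts-⊑ _ Ps)

    matchTerm-sound : ∀ (σ : Subst) {s} (t : Term sig (_∈ vs) s) (σ′ : Subst) →
                      matchTerm σ t (instT sig σ₀ t) ⊑ σ′ → instT sig σ′ t ≡ instT sig σ₀ t
    matchTerm-sound σ (const _ _) σ′ _     = refl
    matchTerm-sound σ (var x)     σ′ ⊑σ′ = ⊑σ′ x (≔-self σ x (σ₀ x))

    matchArgs-sound : ∀ (σ : Subst) {ss} (ts : All (Term sig (_∈ vs)) ss) (σ′ : Subst) →
                      matchArgs σ ts (All.map (instT sig σ₀) ts) ⊑ σ′ →
                      All.map (instT sig σ′) ts ≡ All.map (instT sig σ₀) ts
    matchArgs-sound σ []       σ′ _    = refl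
    matchArgs-sound σ (t ∷ ts) σ′ ⊑σ′ =
      cong₂ _∷_ (matchTerm-sound σ t σ′ (⊑-trans (matchArgs-⊑ _ ts) ⊑σ′))
                (matchArgs-sound _ ts σ′ ⊑σ′)

    matchFact-sound : ∀ (σ : Subst) P (σ′ : Subst) →
                      matchFact σ P (inst sig σ₀ P) ⊑ σ′ → inst sig σ′ P ≡ inst sig σ₀ P
    matchFact-sound σ (fact p ts) σ′ ⊑σ′ with p Fin.≟ p
    ... | yes refl = cong (gfact p) (matchArgs-sound σ ts σ′ ⊑σ′)
    ... | no p≢p   = contradiction refl p≢p

    matchFacts-sound : ∀ (σ : Subst) Ps (σ′ : Subst) → matchFacts σ Ps (map (inst sig σ₀) Ps) ⊑ σ′ →
                       All (λ P → inst sig σ′ P ≡ inst sig σ₀ P) Ps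
    matchFacts-sound σ []       σ′ _    = []
    matchFacts-sound σ (P ∷ Ps) σ′ ⊑σ′ =
      matchFact-sound σ P σ′ (⊑-trans (matchFacts-⊑ _ Ps) ⊑σ′) ∷ matchFacts-sound _ Ps σ′ ⊑σ′

module _ {sig : Sig} (r : Rule sig) (S : Config sig) where
  open Rule r
  open Config S
  open Matching {sig} vars using (Subst; matchFacts; matchFacts-sound)

  private
    Stamped : Set
    Stamped = List (GFact sig × ℕ)

  -- Reading a candidate instance ys of the precondition  W ++ F  back into a substitution
  -- and a timing; the default nonce 0 only concerns variables absent from  W ++ F.
  readσ : Stamped → Subst
  readσ ys = matchFacts (λ _ → nonce 0) (W ++ F) (map proj₁ ys)

  readτ : Stamped → TVar (length W) (length F) → ℕ
  readτ ys now   = time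
  readτ ys (w i) = stampsOf W ys i
  readτ ys (f i) = stampsOf F (drop (length W) ys) i

  IsPreInstance : Stamped → Set
  IsPreInstance ys = Pre sig r (readσ ys) (readτ ys) ≡ ys × All (holds (readτ ys)) C

  isPreInstance? : ∀ ys → Dec (IsPreInstance ys)
  isPreInstance? ys = Pre sig r (readσ ys) (readτ ys) ≟ˢ ys ×-dec all? (holds? (readτ ys)) C

  length-Pre : (σ : Subst) (τ : TVar (length W) (length F) → ℕ) →
               length (Pre sig r σ τ) ≡ length W + length F
  length-Pre σ τ = trans (length-++ (stampWith W (inst sig σ) (τ ∘ w)))
                         (cong₂ _+_ (length-stampWith W _ _) (length-stampWith F _ _))

  Pre-isPreInstance : (ap : Applicable sig r S) → let open Applicable ap in IsPreInstance (Pre sig r σ τ)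
  Pre-isPreInstance ap = Pre-read , All.map (holds-cong (λ v → sym (readτ-Pre v)) _) cons
    where
    open Applicable ap
    sW sF : Stamped
    sW = stampWith W (inst sig σ) (τ ∘ w)
    sF = stampWith F (inst sig σ) (τ ∘ f)

    readτ-Pre : ∀ v → readτ (sW ++ sF) v ≡ τ v
    readτ-Pre now   = sym timeMatch
    readτ-Pre (w i) = stampsOf-stampWith W (inst sig σ) (τ ∘ w) sF i
    readτ-Pre (f i) = begin
      stampsOf F (drop (length W) (sW ++ sF)) i  ≡⟨ cong (stampsOf′ F i) (drop-stampWith W _ _ sF) ⟩
      stampsOf F sF i                            ≡⟨ cong (stampsOf′ F i) (sym (List.++-identityʳ sF)) ⟩
      stampsOf F (sF ++ []) i                    ≡⟨ stampsOf-stampWith F (inst sig σ) (τ ∘ f) [] i ⟩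
      τ (f i)                                    ∎
      where
      open ≡-Reasoning
      stampsOf′ : ∀ xs → Fin (length xs) → Stamped → ℕ
      stampsOf′ xs i ys = stampsOf xs ys i

    facts-Pre : map proj₁ (sW ++ sF) ≡ map (inst sig σ) (W ++ F)
    facts-Pre = begin
      map proj₁ (sW ++ sF)                    ≡⟨ map-++ proj₁ sW sF ⟩
      map proj₁ sW ++ map proj₁ sF
        ≡⟨ cong₂ _++_ (map-proj₁-stampWith W _ _) (map-proj₁-stampWith F _ _) ⟩
      map (inst sig σ) W ++ map (inst sig σ) F ≡⟨ sym (map-++ (inst sig σ) W F) ⟩
      map (inst sig σ) (W ++ F)               ∎
      where open ≡-Reasoning

    readσ-Pre : All (λ P → inst sig (readσ (sW ++ sF)) P ≡ inst sig σ P) (W ++ F)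
    readσ-Pre = subst (λ Gs → All (λ P → inst sig (matchFacts _ (W ++ F) Gs) P ≡ inst sig σ P) (W ++ F))
                      (sym facts-Pre) (matchFacts-sound σ _ (W ++ F) _ (λ _ σ′x≡ → σ′x≡))

    Pre-read : Pre sig r (readσ (sW ++ sF)) (readτ (sW ++ sF)) ≡ sW ++ sF
    Pre-read = let readσ-W , readσ-F = All.++⁻ W readσ-Pre in
      cong₂ _++_ (stampWith-cong W readσ-W (readτ-Pre ∘ w)) (stampWith-cong F readσ-F (readτ-Pre ∘ f))

  applicable? : Dec (Applicable sig r S)
  applicable? with any? (isPreInstance? ∘ Split.taken) (splits (length W + length F) facts)
  ... | yes found =
    let split ys zs perm , Pre≡ys , cs = Any.satisfied found in
    yes record { σ = readσ ys ; τ = readτ ys ; rest = zs ; timeMatch = refl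
               ; sub = subst (λ xs → facts ↭ xs ++ zs) (sym Pre≡ys) perm ; cons = cs }
  ... | no none = no λ ap → let open Applicable ap in
    none (subst (λ k → Any (IsPreInstance ∘ Split.taken) (splits k facts)) (length-Pre σ τ)
                (Any.map (λ { refl → Pre-isPreInstance ap }) (splits-complete (Pre sig r σ τ) sub)))

module _ {sig : Sig} where

  argsNonceSum : ∀ {ss} → All (Val sig) ss → ℕ
  argsNonceSum []             = 0
  argsNonceSum (cst _ _ ∷ us) = argsNonceSum us
  argsNonceSum (nonce k ∷ us) = k + argsNonceSum us

  nonceSum : List (GFact sig × ℕ) → ℕ
  nonceSum []              = 0
  nonceSum ((G , _) ∷ fts) = argsNonceSum (GFact.args G) + nonceSum fts

  occursArgs⇒≤ : ∀ {k ss} (us : All (Val sig) ss) → occursArgs sig k us → k ≤ argsNonceSum us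
  occursArgs⇒≤ (cst _ _ ∷ us) (inj₂ k∈us)   = occursArgs⇒≤ us k∈us
  occursArgs⇒≤ (nonce k ∷ us) (inj₁ refl)   = m≤m+n k _
  occursArgs⇒≤ (nonce j ∷ us) (inj₂ k∈us)   = ≤-trans (occursArgs⇒≤ us k∈us) (m≤n+m _ j)

  occurs⇒≤nonceSum : ∀ {k} fts → Any (λ ft → occursArgs sig k (GFact.args (proj₁ ft))) fts →
                     k ≤ nonceSum fts
  occurs⇒≤nonceSum ((G , _) ∷ fts) (here k∈G) = ≤-trans (occursArgs⇒≤ (GFact.args G) k∈G) (m≤m+n _ _)
  occurs⇒≤nonceSum ((G , _) ∷ fts) (there k∈) = ≤-trans (occurs⇒≤nonceSum fts k∈) (m≤n+m _ _)

  -- Fresh values are taken above the sum of all nonces in S, indexed by position.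
  apply : ∀ {r S} → Applicable sig r S → Σ (Config sig) (Apply sig r S)
  apply {r} {S} ap = _ , record
    { app = ap ; ρ = ρ ; result = refl
    ; ρ-inj = λ p q ρp≡ρq →
        ∈-index-injective p q (Fin.toℕ-injective (+-cancelˡ-≡ (suc bound) _ _ ρp≡ρq))
    ; ρ-fresh = λ p occ → <⇒≱ (s≤s (m≤m+n bound _)) (occurs⇒≤nonceSum (Config.facts S) occ) }
    where
    bound : ℕ
    bound = nonceSum (Config.facts S)
    ρ : ∀ {s} → s ∈ Rule.fresh r → ℕ
    ρ p = suc bound + toℕ (index p)

  due : Config sig → ℕ
  due S = length (filter (λ ft → proj₂ ft ≤? Config.time S) (Config.facts S))

  consumed-due : ∀ {r S} → Progressing sig r → (ap : Applicable sig r S) →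
                 ∀ i → Applicable.τ ap (f i) ≤ Config.time S
  consumed-due (_ , _ , F-past) ap i =
    subst (τ (f i) ≤_) timeMatch (subst (_≤ τ now) (+-identityʳ _) (All.lookup cons (F-past i)))
    where open Applicable ap

  due-decreasing : ∀ {r S S′} → Progressing sig r → Apply sig r S S′ → due S′ < due S
  due-decreasing {r} {S} prog@(|Q|≡|F| , late , _) record { app = ap ; ρ = ρ ; result = refl } = begin-strict
    # (sW ++ sQ ++ rest)    ≡⟨ #-++ sW (sQ ++ rest) ⟩
    # sW + # (sQ ++ rest)   ≡⟨ cong (# sW +_) (#-++ sQ rest) ⟩
    # sW + (# sQ + # rest)  <⟨ +-monoʳ-< (# sW) (+-monoˡ-< (# rest) #sQ<#sF) ⟩
    # sW + (# sF + # rest)  ≡⟨ sym (+-assoc (# sW) (# sF) (# rest)) ⟩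
    # sW + # sF + # rest    ≡⟨ cong (_+ # rest) (sym (#-++ sW sF)) ⟩
    # (sW ++ sF) + # rest   ≡⟨ sym (#-++ (sW ++ sF) rest) ⟩
    # ((sW ++ sF) ++ rest)  ≡⟨ sym (↭-length (filter-↭ (λ ft → proj₂ ft ≤? T) sub)) ⟩
    # (Config.facts S)      ∎
    where
    open Applicable ap
    open ≤-Reasoning
    T : ℕ
    T = Config.time S
    # : List (GFact sig × ℕ) → ℕ
    # xs = length (filter (λ ft → proj₂ ft ≤? T) xs)
    #-++ : ∀ xs ys → # (xs ++ ys) ≡ # xs + # ys
    #-++ xs ys = trans (cong length (filter-++ _ xs ys)) (length-++ (filter _ xs))
    sW sF sQ : List (GFact sig × ℕ)
    sW = stampWith (Rule.W r) (inst sig σ) (τ ∘ w)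
    sF = stampWith (Rule.F r) (inst sig σ) (τ ∘ f)
    sQ = map (λ qd → inst sig (extend sig r σ ρ) (proj₁ qd) , T + proj₂ qd) (Rule.Q r)
    #sQ<#sF : # sQ < # sF
    #sQ<#sF = begin-strict
      # sQ               <⟨ filter-notAll _ sQ (Any.map⁺ (Any.map (λ 1≤d → <⇒≱ (m<m+n T 1≤d)) late)) ⟩
      length sQ          ≡⟨ length-map _ (Rule.Q r) ⟩
      length (Rule.Q r)  ≡⟨ |Q|≡|F| ⟩
      length (Rule.F r)  ≡⟨ sym (length-stampWith (Rule.F r) _ _) ⟩
      length sF          ≡⟨ cong length (sym (filter-all _ (stampWith-All (Rule.F r) _ _ (consumed-due prog ap)))) ⟩
      # sF               ∎

  module _ {R : List (Rule sig)} where

    record LazyRun (S : Config sig) (k : ℕ) : Set where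
      constructor lazyRun
      field
        {end}  : Config sig
        trace  : Trace sig R S end
        lazy   : LTS sig trace
        ticked : ticks sig trace ≡ k

    module _ (progressing : All (Progressing sig) R) where

      saturate : ∀ S → Acc _<_ (due S) → Σ (LazyRun S 0) (Stuck R ∘ LazyRun.end)
      saturate S (acc smaller) with any? (λ r → applicable? r S) R
      ... | no stuck = lazyRun done tt refl , stuck
      ... | yes applicable =
        let r , r∈R , ap = find applicable
            S′ , S→S′ = apply ap
            due-S′<due-S = due-decreasing (All.lookup progressing r∈R) S→S′
            lazyRun tr lazy ticked , stuck = saturate S′ (smaller due-S′<due-S)
        in lazyRun (step (instS r∈R S→S′) tr) lazy ticked , stuck

      lazyRunOf : ∀ k S → LazyRun S k
      lazyRunOf zero    S = lazyRun done tt refl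
      lazyRunOf (suc k) S =
        let lazyRun tr lazy ticked , stuck = saturate S (<-wellFounded (due S))
            lazyRun tr′ lazy′ ticked′ = lazyRunOf k (tickC sig _)
            tr″ = step tickS tr′
        in lazyRun (_++ₜ_ sig tr tr″) (LTS-++ₜ tr tr″ lazy (stuck , lazy′))
                   (trans (ticks-++ₜ tr tr″) (cong₂ _+_ ticked (cong suc ticked′)))

nL-extension : ∀ n X → nZ n X →
               (let open System X in
                ∀ {S′} (tr : Trace sig rules init S′) →
                Compliant sig spec tr → LTS sig tr → ticks sig tr ≤ n →
                Σ (LazyRun S′ (n ∸ ticks sig tr)) (Compliant sig spec ∘ LazyRun.trace)) →
               nL n X
nL-extension n X nz extend = nz , λ S′ tr c lazy ticks≤n →
  let open System X
      lazyRun ext lazy′ ticked , c′ = extend tr c lazy ticks≤n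
  in _ , ext , Compliant-++ₜ tr ext c c′ , LTS-++ₜ tr ext lazy lazy′
     , trans (ticks-++ₜ tr ext) (trans (cong (ticks sig tr +_) ticked) (m+[n∸m]≡n ticks≤n))

nS⇒nL : ∀ n X → nSPTS n X → nLPTS n X
nS⇒nL n X (progressing , nz , allCompliant) = progressing , nL-extension n X nz λ {S′} tr _ lazy ticks≤n →
  let open System X
      lazyRun ext lazy′ ticked = lazyRunOf progressing (n ∸ ticks sig tr) S′
      lazy″ = LTS-++ₜ tr ext lazy lazy′
      ticked″ = trans (ticks-++ₜ tr ext) (trans (cong (ticks sig tr +_) ticked) (m+[n∸m]≡n ticks≤n))
  in lazyRun ext lazy′ ticked , Compliant-++ₜ⁻ʳ tr ext (allCompliant _ (_++ₜ_ sig tr ext) lazy″ ticked″)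

module Examples where

  sig₀ : Sig
  sig₀ = record { nSort = 0 ; nPred = 3 ; arity = λ _ → [] ; nConst = 0 ; constSort = λ () }

  a b c : Fin 3
  a = zero
  b = suc zero
  c = suc (suc zero)

  atom : Fin 3 → GFact sig₀
  atom p = gfact p []

  -- Time@T, a@T′ | T ≥ T′ → Time@T, p@(T+1)
  consumeA : Fin 3 → Rule sig₀
  consumeA p = record { vars = [] ; fresh = [] ; W = [] ; F = fact a [] ∷ []
                      ; Q = (fact p [] , 1) ∷ [] ; C = con ge now plus (f zero) 0 ∷ [] }

  consumeA-progressing : ∀ p → Progressing sig₀ (consumeA p)
  consumeA-progressing p = refl , here (s≤s z≤n) , λ { zero → here refl }

  consumeA-needs-dueA : ∀ {p S} → Applicable sig₀ (consumeA p) S →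
                        ∃ λ d → (atom a , d) ∈ Config.facts S × d ≤ Config.time S
  consumeA-needs-dueA ap =
    Applicable.τ ap (f zero) , ∈-resp-↭ (↭-sym (Applicable.sub ap)) (here refl)
    , consumed-due (consumeA-progressing _) ap zero

  consumeA-apply : ∀ p {t d} → d ≤ t →
                   Apply sig₀ (consumeA p) (config t [ (atom a , d) ]) (config t [ (atom p , t + 1) ])
  consumeA-apply p {t} {d} d≤t = record
    { app = record { σ = λ () ; τ = τ ; rest = [] ; timeMatch = refl ; sub = ↭-refl
                   ; cons = subst (_≤ t) (sym (+-identityʳ d)) d≤t ∷ [] }
    ; ρ = λ () ; ρ-inj = λ () ; ρ-fresh = λ () ; result = refl }
    where
    τ : TVar 0 1 → ℕ
    τ now      = t
    τ (f zero) = d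

  Stuck-consumeA : ∀ ps {S} → (∀ {d} → (atom a , d) ∈ Config.facts S → Config.time S < d) →
                   Stuck (map consumeA ps) S
  Stuck-consumeA ps notDue applicable with _ , ap ← Any.satisfied (Any.map⁻ applicable) =
    let _ , a∈S , d≤t = consumeA-needs-dueA ap in <⇒≱ (notDue a∈S) d≤t

  map-consumeA-progressing : ∀ ps → All (Progressing sig₀) (map consumeA ps)
  map-consumeA-progressing ps = All.map⁺ (All.universal consumeA-progressing ps)

  b-pattern⇒b∈ : ∀ {cp S} i → (just (fact b []) , i) ∈ CritPat.pats cp → CritMatch sig₀ cp S →
                 ∃ λ x → (just (atom b) , x) ∈ fullMS sig₀ S
  b-pattern⇒b∈ i b∈cp m = τ i , ∈-resp-↭ (↭-sym sub) (∈-++⁺ˡ (∈-map⁺ _ b∈cp))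
    where open CritMatch m

  b∉ : ∀ {p t d x} → p ≢ b → (just (atom b) , x) ∉ fullMS sig₀ (config t [ (atom p , d) ])
  b∉ p≢b (here ())
  b∉ p≢b (there (here refl)) = p≢b refl

  anyB : CritPat sig₀
  anyB = record { vars = [] ; nT = 1 ; pats = [ (just (fact b []) , zero) ] ; C = [] }

  lateB : ℕ → System
  lateB n = record { sig = sig₀ ; rules = map consumeA [ b ] ; init = config 0 [ (atom a , n) ] ; spec = [ anyB ] }

  module _ (n : ℕ) where
    open System (lateB n) using (rules; spec)

    lateB-¬Critical : ∀ {p t d} → p ≢ b → ¬ Critical sig₀ spec (config t [ (atom p , d) ])
    lateB-¬Critical p≢b (here m) = b∉ p≢b (proj₂ (b-pattern⇒b∈ zero (here refl) m))

    lateB-stuck : ∀ {t} → t < n → Stuck rules (config t [ (atom a , n) ])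
    lateB-stuck t<n = Stuck-consumeA [ b ] λ { (here refl) → t<n }

    b-Critical : ∀ {t x fs} → Critical sig₀ spec (config t ((atom b , x) ∷ fs))
    b-Critical {x = x} = here record { σ = λ () ; τ = λ _ → x ; rest = _ ; sub = swap _ _ ↭-refl ; cons = [] }

    lateB-compliant⇒idle : ∀ {t S} (tr : Trace sig₀ rules (config t [ (atom a , n) ]) S) →
                           Compliant sig₀ spec tr → S ≡ config (t + ticks sig₀ tr) [ (atom a , n) ]
    lateB-compliant⇒idle {t} done            _       = cong (λ u → config u _) (sym (+-identityʳ t))
    lateB-compliant⇒idle {t} (step tickS tr) (_ , c) =
      trans (lateB-compliant⇒idle tr c) (cong (λ u → config u [ (atom a , n) ]) (sym (+-suc t _)))
    lateB-compliant⇒idle (step (instS (here refl) ap) tr) (_ , c) =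
      contradiction (subst (Critical sig₀ spec) (sym (Apply.result ap)) b-Critical) (Compliant⇒¬Critical tr c)

    lateB-wait : ∀ m {t} (e : m + t ≡ n) →
                 Σ (LazyRun (config t [ (atom a , n) ]) m) (Compliant sig₀ spec ∘ LazyRun.trace)
    lateB-wait m e = lazyRun (idle _ m e) (LTS-idle _ m e lateB-stuck) (ticks-idle _ m e)
                   , Compliant-idle _ m e (λ _ → lateB-¬Critical λ ())

    lateB-nZ : nZ n (lateB n)
    lateB-nZ = let lazyRun tr lazy ticked , c = lateB-wait n (+-identityʳ n) in _ , tr , c , lazy , ticked

    lateB-nL : nL n (lateB n)
    lateB-nL = nL-extension n (lateB n) lateB-nZ λ tr c _ ticks≤n →
      subst (λ S → Σ (LazyRun S (n ∸ ticks sig₀ tr)) (Compliant sig₀ spec ∘ LazyRun.trace))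
            (sym (lateB-compliant⇒idle tr c)) (lateB-wait (n ∸ ticks sig₀ tr) (m∸n+n≡m ticks≤n))

    lateB-¬nS : ¬ nS n (lateB n)
    lateB-¬nS (_ , allCompliant) =
      let lazyRun tr lazy ticked , _ = lateB-wait n (+-identityʳ n)
          fire = step (instS (here refl) (consumeA-apply b ≤-refl)) done
          ticked′ = trans (ticks-++ₜ tr fire) (trans (cong (_+ 0) ticked) (+-identityʳ n))
          _ , fired-¬Critical = Compliant-++ₜ⁻ʳ tr fire (allCompliant _ _ (LTS-++ₜ tr fire lazy tt) ticked′)
      in fired-¬Critical b-Critical

  dueB : CritPat sig₀
  dueB = record { vars = [] ; nT = 2 ; pats = (nothing , zero) ∷ (just (fact b []) , suc zero) ∷ []
                ; C = con ge zero plus (suc zero) 0 ∷ [] }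

  choice : System
  choice = record { sig = sig₀ ; rules = map consumeA (b ∷ c ∷ []) ; init = config 0 [ (atom a , 0) ]
                  ; spec = [ dueB ] }

  open System choice using (rules; spec)

  choice-¬Critical : ∀ {p t d} → p ≢ b → ¬ Critical sig₀ spec (config t [ (atom p , d) ])
  choice-¬Critical p≢b (here m) = b∉ p≢b (proj₂ (b-pattern⇒b∈ (suc zero) (there (here refl)) m))

  choice-¬Critical₀ : ¬ Critical sig₀ spec (config 0 [ (atom b , 1) ])
  choice-¬Critical₀ (here m) =
    <⇒≱ (s≤s z≤n) (subst₂ _≤_ (trans (+-identityʳ _) τ₁≡1) τ₀≡0 (All.head cons))
    where
    open CritMatch m
    τ₀≡0 : τ zero ≡ 0
    τ₀≡0 = nothing∈fullMS⇒time (∈-resp-↭ (↭-sym sub) (here refl))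
    τ₁≡1 : τ (suc zero) ≡ 1
    τ₁≡1 with there (here τ₁≡) ← proj₂ (b-pattern⇒b∈ (suc zero) (there (here refl)) m) =
      cong proj₂ τ₁≡

  choice-Critical : ∀ {t} → Critical sig₀ spec (config (suc t) [ (atom b , 1) ])
  choice-Critical {t} = here record { σ = λ () ; τ = τ ; rest = [] ; sub = ↭-refl ; cons = s≤s z≤n ∷ [] }
    where
    τ : Fin 2 → ℕ
    τ zero       = suc t
    τ (suc zero) = 1

  choice-nZ : ∀ n → nZ n choice
  choice-nZ n = _ , step (instS (there (here refl)) (consumeA-apply c z≤n)) (idle _ n (+-identityʳ n))
              , (choice-¬Critical (λ ()) , Compliant-idle _ n _ (λ _ → choice-¬Critical λ ()))
              , LTS-idle _ n _ (λ _ → Stuck-consumeA (b ∷ c ∷ []) λ { (here ()) })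
              , ticks-idle _ n _

  choice-stranded : ∀ {S} (ext : Trace sig₀ rules (config 0 [ (atom b , 1) ]) S) →
                    1 ≤ ticks sig₀ ext → ¬ Compliant sig₀ spec ext
  choice-stranded (step tickS ext)        _ (_ , c) = Compliant⇒¬Critical ext c choice-Critical
  choice-stranded (step (instS r∈R ap) _) _ _       =
    Stuck⇒¬Apply (Stuck-consumeA (b ∷ c ∷ []) λ { (here ()) }) r∈R ap

  choice-¬nL : ∀ n → 1 ≤ n → ¬ nL n choice
  choice-¬nL n 1≤n (_ , extend) =
    let _ , ext , c , _ , ticked = extend _ chooseB (choice-¬Critical (λ ()) , choice-¬Critical₀) tt z≤n
    in choice-stranded ext (subst (1 ≤_) (sym ticked) 1≤n) (Compliant-++ₜ⁻ʳ chooseB ext c)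
    where
    chooseB : Trace sig₀ rules (config 0 [ (atom a , 0) ]) (config 0 [ (atom b , 1) ])
    chooseB = step (instS (here refl) (consumeA-apply b z≤n)) done

open Examples

corollary3 : (n : ℕ) → 1 ≤ n → (nSPTS n ⊊ nLPTS n) × (nLPTS n ⊊ nZPTS n)
corollary3 n 1≤n =
  (nS⇒nL n , lateB n , (map-consumeA-progressing [ b ] , lateB-nL n) , lateB-¬nS n ∘ proj₂) ,
  (nL⇒nZ , choice , (map-consumeA-progressing (b ∷ c ∷ []) , choice-nZ n) , choice-¬nL n 1≤n ∘ proj₂)
  where
  nL⇒nZ : ∀ X → nLPTS n X → nZPTS n X
  nL⇒nZ _ (progressing , nz , _) = progressing , nz
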